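{- Let $\alpha\in F$. Then $\alpha$ is Dirichlet $\varepsilon$-improvable for some $0<\varepsilon\leq\frac1e$ if and only if $\alpha\in\mathbb{F}_q(T)$.
   Context: Let $q$ be a prime power, $\Lambda=\mathbb{F}_q[T]$ and $F=\mathbb{F}_q((T^{ -1}))$. For nonzero $a=\sum_{j\leq j_0}a_jT^j\in F$ with $a_{j_0}\neq 0$, $|a|=e^{j_0}$; $|0|=0$. For $0<\varepsilon\leq\frac1e$, $\alpha\in F$ is called Dirichlet $\varepsilon$-improvable if there exists $N_0\in\mathbb{N}$ such that for every $n\geq N_0$ there exist $p,q\in\Lambda$ with $|q\alpha-p|<\frac{\varepsilon}{e^n}$ and $1\leq|q|<\varepsilon e^n$. -}

module Defs where

open import Level using (Level; _⊔_; suc)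
open import Data.Nat as ℕ using (ℕ; zero; suc)
open import Data.Integer as ℤ using (ℤ; +_; -[1+_])
open import Data.Fin using (Fin)
open import Data.List using (List; []; _∷_)
open import Data.Product using (Σ; ∃; ∃-syntax; _×_)
open import Relation.Nullary using (¬_)
open import Relation.Binary.PropositionalEquality using (_≡_)
open import Algebra.Bundles using (CommutativeRing)

record FiniteField (c ℓ : Level) : Set (Level.suc (c ⊔ ℓ)) where
  field
    commRing : CommutativeRing c ℓ
  open CommutativeRing commRing public
  field
    1≉0     : ¬ (1# ≈ 0#)
    inverse : ∀ x → ¬ (x ≈ 0#) → ∃[ y ] (x * y ≈ 1#)
    size    : ℕ
    enum    : Fin size → Carrier
    enum-surj : ∀ x → ∃[ i ] (enum i ≈ x)
    enum-inj  : ∀ i j → enum i ≈ enum j → i ≡ j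

module _ {c ℓ : Level} (𝔽 : FiniteField c ℓ) where
  open FiniteField 𝔽

  -- Polynomials in Λ = 𝔽[T]: coefficient lists, constant term first.
  Poly : Set c
  Poly = List Carrier

  coeff : Poly → ℕ → Carrier
  coeff []       _       = 0#
  coeff (a ∷ _)  zero    = a
  coeff (_ ∷ as) (suc i) = coeff as i

  coeffℤ : Poly → ℤ → Carrier
  coeffℤ p (+ n)    = coeff p n
  coeffℤ p -[1+ n ] = 0#

  NonzeroPoly : Poly → Set ℓ
  NonzeroPoly p = ∃[ i ] (¬ (coeff p i ≈ 0#))

  -- Elements of F = 𝔽((T⁻¹)): α = Σ_j α_j T^j with α_j = 0 for j > top.
  record Laurent : Set (c ⊔ ℓ) where
    field
      cf     : ℤ → Carrier
      top    : ℤ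
      vanish : ∀ j → top ℤ.< j → cf j ≈ 0#
  open Laurent public

  -- Coefficient of T^j in the product p · α (p ∈ Λ, α ∈ F):
  -- Σ_i p_i α_{j-i}.
  mulCf : Poly → (ℤ → Carrier) → ℤ → Carrier
  mulCf []       α j = 0#
  mulCf (a ∷ as) α j = a * α j + mulCf as α (j ℤ.- + 1)

  errCf : Poly → Poly → Laurent → ℤ → Carrier
  errCf p q α j = mulCf q (cf α) j - coeffℤ p j

  IsRational : Laurent → Set (c ⊔ ℓ)
  IsRational α = ∃[ a ] ∃[ b ] (NonzeroPoly b × (∀ j → mulCf b (cf α) j ≈ coeffℤ a j))

  -- Dirichlet ε-improvability, where k = -⌈log ε⌉ (so k ≥ 1 ⇔ 0 < ε ≤ 1/e).
  -- Since |·| takes values in e^ℤ ∪ {0}: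
  --   |qα - p| < ε/eⁿ  ⇔  all coefficients of qα-p at T^j, j ≥ -k-n, vanish;
  --   |q| < ε eⁿ       ⇔  deg q ≤ n-k-1, i.e. coefficients at T^i, i ≥ n-k, vanish;
  --   1 ≤ |q|          ⇔  q ≠ 0.
  DirichletImprovable : ℕ → Laurent → Set (c ⊔ ℓ)
  DirichletImprovable k α =
    ∃[ N₀ ] ∀ (n : ℕ) → N₀ ℕ.≤ n →
      ∃[ p ] ∃[ q ]
        ( NonzeroPoly q
        × (∀ (i : ℕ) → (+ n) ℤ.- (+ k) ℤ.≤ + i → coeff q i ≈ 0#)
        × (∀ (j : ℤ) → (ℤ.- (+ k)) ℤ.- (+ n) ℤ.≤ j → errCf p q α j ≈ 0#))

{-# OPTIONS --safe #-}
-- If α is improvable, the approximations qₜα − pₜ at the levels n = N₀ + t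
-- are so small that q₍ₜ₊₁₎(qₜα − pₜ) − qₜ(q₍ₜ₊₁₎α − p₍ₜ₊₁₎), which is the
-- polynomial qₜp₍ₜ₊₁₎ − q₍ₜ₊₁₎pₜ, has negative degree and hence vanishes.
-- Cancelling the nonzero qₜ in F, induction on t gives
-- qₜ(q₀α − p₀) = q₀(qₜα − pₜ), whose degree tends to −∞ with t; so
-- q₀α = p₀.  Conversely α = a/b is approximated exactly by p = a, q = b.
module Submission where

open import Defs
open import Level using (Level)
open import Data.Nat using (ℕ)
open import Data.Product using (∃-syntax; _×_)
open import Function.Bundles using (_⇔_)

open import Data.Nat as ℕ using (zero; suc; z≤n; s≤s)
import Data.Nat.Properties as ℕₚ
open import Data.Integer as ℤ using (ℤ; +_; -[1+_]; 1ℤ; _⊖_)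
import Data.Integer.Properties as ℤₚ
open import Data.Integer.Tactic.RingSolver using (solve-∀)
open import Data.List using ([]; _∷_; length)
open import Data.Product using (_,_; proj₁; proj₂)
open import Data.Sum as Sum using (_⊎_; inj₁; inj₂)
open import Data.Empty using (⊥-elim)
open import Data.Fin.Properties using () renaming (_≟_ to _≟ᶠ_)
open import Relation.Nullary using (¬_; Dec; yes; no)
open import Relation.Binary.Definitions using (tri<; tri≈; tri>)
open import Relation.Binary.PropositionalEquality as ≡ using (_≡_; _≢_)
open import Function.Base using (_∘_)
open import Function.Bundles using (mk⇔)

module _ where
  open import Data.Integer using (_+_; _-_; -_; _≤_; _<_; ∣_∣; pred; -1ℤ)
  open ℤₚ using (≤-reflexive; ≤-trans; +-monoˡ-≤; +-monoʳ-≤; neg-mono-≤)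
  open ℤₚ.≤-Reasoning

  i≤+∣i∣ : ∀ i → i ≤ + ∣ i ∣
  i≤+∣i∣ (+ n)    = ℤₚ.≤-refl
  i≤+∣i∣ -[1+ n ] = ℤ.-≤+

  i≤j+∣i-j∣ : ∀ i j → i ≤ j + + ∣ i - j ∣
  i≤j+∣i-j∣ i j = begin
    i             ≡⟨ split i j ⟩
    j + (i - j)   ≤⟨ +-monoʳ-≤ j (i≤+∣i∣ (i - j)) ⟩
    j + + ∣ i - j ∣ ∎
    where
    split : ∀ i j → i ≡ j + (i - j)
    split = solve-∀

  j-[1+i]≡[j-1]-i : ∀ j i → j - + suc i ≡ (j - 1ℤ) - + i
  j-[1+i]≡[j-1]-i j i = shift j (+ i)
    where
    shift : ∀ j i → j - (1ℤ + i) ≡ (j - 1ℤ) - i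
    shift = solve-∀

  [i+j]-j≡i : ∀ i j → (i + j) - j ≡ i
  [i+j]-j≡i = solve-∀

  i+[1+n]≡1+[i+n] : ∀ i n → i + + suc n ≡ 1ℤ + (i + + n)
  i+[1+n]≡1+[i+n] i n = reassociate i (+ n)
    where
    reassociate : ∀ i n → i + (1ℤ + n) ≡ 1ℤ + (i + n)
    reassociate = solve-∀

  m≤n⇒m⊖n≤+k : ∀ {m n} k → m ℕ.≤ n → m ⊖ n ≤ + k
  m≤n⇒m⊖n≤+k k m≤n = ≤-trans (≤-reflexive (ℤₚ.⊖-≤ m≤n)) ℤₚ.neg-≤-pos

  [A+B]-1≤j∧i<A⇒B≤j-i : ∀ {A B j i} → (A + B) - 1ℤ ≤ j → + i < A → B ≤ j - + i
  [A+B]-1≤j∧i<A⇒B≤j-i {A} {B} {j} {i} A+B-1≤j i<A = begin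
    B                             ≡⟨ split A B ⟩
    ((A + B) - 1ℤ) - pred A       ≤⟨ +-monoˡ-≤ (- pred A) A+B-1≤j ⟩
    j - pred A                    ≤⟨ +-monoʳ-≤ j (neg-mono-≤ (ℤₚ.i<j⇒i≤pred[j] i<A)) ⟩
    j - + i                       ∎
    where
    split : ∀ A B → B ≡ ((A + B) - 1ℤ) - (-1ℤ + A)
    split = solve-∀

  i<d⇒1+T≤[T+d]-i : ∀ T {i d} → i ℕ.< d → 1ℤ + T ≤ (T + + d) - + i
  i<d⇒1+T≤[T+d]-i T {i} {d} i<d = begin
    1ℤ + T                  ≡⟨ cancel T (+ i) ⟩
    (T + + suc i) - + i     ≤⟨ +-monoˡ-≤ (- + i) (+-monoʳ-≤ T (ℤ.+≤+ i<d)) ⟩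
    (T + + d) - + i         ∎
    where
    cancel : ∀ T i → 1ℤ + T ≡ (T + (1ℤ + i)) - i
    cancel = solve-∀

  -- The degree bound of qₐ(q_bα − p_b) at the levels a + N and b + N.
  [a+N-k]+[-k-[b+N]]-1≤a⊖[1+b] : ∀ k N a b →
    ((+ (a ℕ.+ N) - + k) + (- + k - + (b ℕ.+ N))) - 1ℤ ≤ a ⊖ suc b
  [a+N-k]+[-k-[b+N]]-1≤a⊖[1+b] k N a b = begin
    ((+ (a ℕ.+ N) - + k) + (- + k - + (b ℕ.+ N))) - 1ℤ
      ≡⟨ ≡.cong₂ (λ x y → ((x - + k) + (- + k - y)) - 1ℤ) (ℤₚ.pos-+ a N) (ℤₚ.pos-+ b N) ⟩
    ((+ a + + N - + k) + (- + k - (+ b + + N))) - 1ℤ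
      ≡⟨ regroup (+ a) (+ b) (+ N) (+ k) ⟩
    (+ a - (1ℤ + + b)) - (+ k + + k)
      ≤⟨ ℤₚ.i-j≤i _ (+ (k ℕ.+ k)) ⟩
    + a - + suc b
      ≡⟨ ℤₚ.[+m]-[+n]≡m⊖n a (suc b) ⟩
    a ⊖ suc b ∎
    where
    regroup : ∀ a b N k → ((a + N - k) + (- k - (b + N))) - 1ℤ ≡ (a - (1ℤ + b)) - (k + k)
    regroup = solve-∀

greatest-counterexample : ∀ {p} {P : ℕ → Set p} → (∀ n → Dec (P n)) →
  ∀ K {s} → ¬ P s → (∀ t → K ℕ.< t → P t) → ∃[ t ] (¬ P t × (∀ u → t ℕ.< u → P u))
greatest-counterexample P? K ¬Ps P-above with P? K
... | no ¬PK = K , ¬PK , P-above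
greatest-counterexample P? zero {zero}  ¬Ps P-above | yes P0 = ⊥-elim (¬Ps P0)
greatest-counterexample P? zero {suc s} ¬Ps P-above | yes _  = ⊥-elim (¬Ps (P-above (suc s) (s≤s z≤n)))
greatest-counterexample {P = P} P? (suc K) ¬Ps P-above | yes PK = greatest-counterexample P? K ¬Ps P-above′
  where
  P-above′ : ∀ t → K ℕ.< t → P t
  P-above′ t K<t with suc K ℕ.≟ t
  ... | yes ≡.refl = PK
  ... | no  K+1≢t  = P-above t (ℕₚ.≤∧≢⇒< K<t K+1≢t)

module _ {c ℓ : Level} (𝔽 : FiniteField c ℓ) where
  open FiniteField 𝔽
  open import Algebra.Properties.Ring ring using (x[y-z]≈xy-xz)
  open import Algebra.Properties.Group +-group using (x∙y⁻¹≈ε⇒x≈y; x≈y⇒x∙y⁻¹≈ε; ε⁻¹≈ε)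
  open import Algebra.Properties.AbelianGroup +-abelianGroup using (⁻¹-∙-comm)
  open import Algebra.Properties.CommutativeSemigroup +-commutativeSemigroup using (interchange)
  open import Algebra.Properties.CommutativeSemigroup *-commutativeSemigroup using (xy∙z≈y∙xz; x∙yz≈y∙xz)
  open import Relation.Binary.Reasoning.Setoid setoid

  infix 4 _≟_ _≋_
  infixr 7 _⋆_

  _≟_ : ∀ x y → Dec (x ≈ y)
  x ≟ y with enum-surj x | enum-surj y
  ... | i , i↦x | j , j↦y with i ≟ᶠ j
  ... | yes ≡.refl = yes (trans (sym i↦x) j↦y)
  ... | no  i≢j    = no λ x≈y → i≢j (enum-inj i j (trans i↦x (trans x≈y (sym j↦y))))

  x≉0∧xy≈0⇒y≈0 : ∀ {x y} → x ≉ 0# → x * y ≈ 0# → y ≈ 0#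
  x≉0∧xy≈0⇒y≈0 {x} {y} x≉0 xy≈0 with inverse x x≉0
  ... | x⁻¹ , xx⁻¹≈1 = begin
    y              ≈⟨ *-identityˡ y ⟨
    1# * y         ≈⟨ *-congʳ xx⁻¹≈1 ⟨
    (x * x⁻¹) * y  ≈⟨ xy∙z≈y∙xz x x⁻¹ y ⟩
    x⁻¹ * (x * y)  ≈⟨ *-congˡ xy≈0 ⟩
    x⁻¹ * 0#       ≈⟨ zeroʳ x⁻¹ ⟩
    0#             ∎

  x≈0∧y≈0⇒x-y≈0 : ∀ {x y} → x ≈ 0# → y ≈ 0# → x - y ≈ 0#
  x≈0∧y≈0⇒x-y≈0 x≈0 y≈0 = trans (+-cong x≈0 (-‿cong y≈0)) (-‿inverseʳ 0#)

  x-y≈x : ∀ {x y} → y ≈ 0# → x - y ≈ x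
  x-y≈x {x} y≈0 = trans (+-congˡ (trans (-‿cong y≈0) ε⁻¹≈ε)) (+-identityʳ x)

  [x-y]+[u-v]≈[x+u]-[y+v] : ∀ x y u v → (x - y) + (u - v) ≈ (x + u) - (y + v)
  [x-y]+[u-v]≈[x+u]-[y+v] x y u v =
    trans (interchange x (- y) u (- v)) (+-congˡ (⁻¹-∙-comm y v))

  coeff-beyond-length : ∀ q {i} → length q ℕ.≤ i → coeff 𝔽 q i ≈ 0#
  coeff-beyond-length []      _       = refl
  coeff-beyond-length (_ ∷ q) (s≤s l≤i) = coeff-beyond-length q l≤i

  leading-coefficient : ∀ q → NonzeroPoly 𝔽 q →
    ∃[ d ] (coeff 𝔽 q d ≉ 0# × (∀ i → d ℕ.< i → coeff 𝔽 q i ≈ 0#))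
  leading-coefficient q (_ , qₛ≉0) =
    greatest-counterexample (λ i → coeff 𝔽 q i ≟ 0#) (length q) qₛ≉0
      (λ t l<t → coeff-beyond-length q (ℕₚ.<⇒≤ l<t))

  Series : Set c
  Series = ℤ → Carrier

  _≋_ : Series → Series → Set ℓ
  f ≋ g = ∀ j → f j ≈ g j

  _⋆_ : Poly 𝔽 → Series → Series
  _⋆_ = mulCf 𝔽

  VanishesFrom : ℤ → Series → Set ℓ
  VanishesFrom B f = ∀ j → B ℤ.≤ j → f j ≈ 0#

  CoeffsVanishFrom : ℤ → Poly 𝔽 → Set ℓ
  CoeffsVanishFrom A q = ∀ (i : ℕ) → A ℤ.≤ + i → coeff 𝔽 q i ≈ 0#

  vanishesFrom-mono : ∀ {B B′ f} → B ℤ.≤ B′ → VanishesFrom B f → VanishesFrom B′ f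
  vanishesFrom-mono B≤B′ f<B j B′≤j = f<B j (ℤₚ.≤-trans B≤B′ B′≤j)

  vanishesFrom-extend : ∀ {T f} → VanishesFrom (1ℤ ℤ.+ T) f → f T ≈ 0# → VanishesFrom T f
  vanishesFrom-extend {T} f<1+T fT≈0 j T≤j with T ℤ.≟ j
  ... | yes ≡.refl = fT≈0
  ... | no  T≢j    = f<1+T j (ℤₚ.i<j⇒suc[i]≤j (ℤₚ.≤∧≢⇒< T≤j T≢j))

  vanishesFrom-minus : ∀ {B f g} → VanishesFrom B f → VanishesFrom B g →
                       VanishesFrom B (λ j → f j - g j)
  vanishesFrom-minus f<B g<B j B≤j = x≈0∧y≈0⇒x-y≈0 (f<B j B≤j) (g<B j B≤j)

  private
    at : ∀ (f : Series) {i j} → i ≡ j → f i ≈ f j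
    at f i≡j = reflexive (≡.cong f i≡j)

    head≈0 : ∀ {a} (g : Series) j → a ≈ 0# ⊎ g (j ℤ.- + 0) ≈ 0# → a * g j ≈ 0#
    head≈0 g j (inj₁ a≈0) = trans (*-congʳ a≈0) (zeroˡ _)
    head≈0 g j (inj₂ g≈0) = trans (*-congˡ (trans (at g (≡.sym (ℤₚ.+-identityʳ j))) g≈0)) (zeroʳ _)

    shifted : ∀ {x : Set ℓ} (g : Series) j i → x ⊎ g (j ℤ.- + suc i) ≈ 0# → x ⊎ g ((j ℤ.- 1ℤ) ℤ.- + i) ≈ 0#
    shifted g j i = Sum.map₂ (trans (at g (≡.sym (j-[1+i]≡[j-1]-i j i))))

  ⋆-congˡ : ∀ q {f g} → f ≋ g → q ⋆ f ≋ q ⋆ g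
  ⋆-congˡ []      f≋g j = refl
  ⋆-congˡ (a ∷ q) f≋g j = +-cong (*-congˡ (f≋g j)) (⋆-congˡ q f≋g _)

  ⋆-zeroʳ : ∀ q → q ⋆ (λ _ → 0#) ≋ λ _ → 0#
  ⋆-zeroʳ []      j = refl
  ⋆-zeroʳ (a ∷ q) j = trans (+-cong (zeroʳ a) (⋆-zeroʳ q _)) (+-identityʳ 0#)

  ⋆-distribˡ-+ : ∀ q f g → q ⋆ (λ i → f i + g i) ≋ λ j → (q ⋆ f) j + (q ⋆ g) j
  ⋆-distribˡ-+ []      f g j = sym (+-identityʳ 0#)
  ⋆-distribˡ-+ (a ∷ q) f g j = trans
    (+-cong (distribˡ a (f j) (g j)) (⋆-distribˡ-+ q f g _))
    (interchange (a * f j) (a * g j) _ _)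

  ⋆[f-g]≋⋆f-⋆g : ∀ q f g → q ⋆ (λ i → f i - g i) ≋ λ j → (q ⋆ f) j - (q ⋆ g) j
  ⋆[f-g]≋⋆f-⋆g []      f g j = sym (-‿inverseʳ 0#)
  ⋆[f-g]≋⋆f-⋆g (a ∷ q) f g j = trans
    (+-cong (x[y-z]≈xy-xz a (f j) (g j)) (⋆[f-g]≋⋆f-⋆g q f g _))
    ([x-y]+[u-v]≈[x+u]-[y+v] (a * f j) (a * g j) _ _)

  ⋆-*-comm : ∀ q b f → q ⋆ (λ i → b * f i) ≋ λ j → b * (q ⋆ f) j
  ⋆-*-comm []      b f j = sym (zeroʳ b)
  ⋆-*-comm (a ∷ q) b f j = trans
    (+-cong (x∙yz≈y∙xz a b (f j)) (⋆-*-comm q b f _))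
    (sym (distribˡ b (a * f j) _))

  ⋆-shift : ∀ q (f : Series) j → (q ⋆ (λ i → f (i ℤ.- 1ℤ))) j ≡ (q ⋆ f) (j ℤ.- 1ℤ)
  ⋆-shift []      f j = ≡.refl
  ⋆-shift (a ∷ q) f j = ≡.cong (λ x → a * f (j ℤ.- 1ℤ) + x) (⋆-shift q f (j ℤ.- 1ℤ))

  ⋆-comm : ∀ q r f → q ⋆ r ⋆ f ≋ r ⋆ q ⋆ f
  ⋆-comm []      r f j = sym (⋆-zeroʳ r j)
  ⋆-comm (a ∷ q) r f j = begin
    a * (r ⋆ f) j + (q ⋆ r ⋆ f) (j ℤ.- 1ℤ)
      ≈⟨ +-congˡ (⋆-comm q r f _) ⟩
    a * (r ⋆ f) j + (r ⋆ q ⋆ f) (j ℤ.- 1ℤ)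
      ≈⟨ +-cong (⋆-*-comm r a f j) (reflexive (⋆-shift r (q ⋆ f) j)) ⟨
    (r ⋆ (λ i → a * f i)) j + (r ⋆ (λ i → (q ⋆ f) (i ℤ.- 1ℤ))) j
      ≈⟨ ⋆-distribˡ-+ r _ _ j ⟨
    (r ⋆ (a ∷ q) ⋆ f) j ∎

  ⋆-coeffℤ-negative : ∀ r p n → (r ⋆ coeffℤ 𝔽 p) -[1+ n ] ≈ 0#
  ⋆-coeffℤ-negative []      p n = refl
  ⋆-coeffℤ-negative (a ∷ r) p n = trans (+-cong (zeroʳ a) (⋆-coeffℤ-negative r p _)) (+-identityʳ 0#)

  -- Below degree 0 the polynomial part p of qα − p is invisible.
  ⋆-errCf-negative : ∀ r p q α n → (r ⋆ errCf 𝔽 p q α) -[1+ n ] ≈ (r ⋆ q ⋆ cf α) -[1+ n ]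
  ⋆-errCf-negative r p q α n =
    trans (⋆[f-g]≋⋆f-⋆g r _ _ _) (x-y≈x (⋆-coeffℤ-negative r p n))

  ⋆-vanishes-at : ∀ q g j → (∀ i → coeff 𝔽 q i ≈ 0# ⊎ g (j ℤ.- + i) ≈ 0#) → (q ⋆ g) j ≈ 0#

  ⋆-single : ∀ q g d j → (∀ i → i ≢ d → coeff 𝔽 q i ≈ 0# ⊎ g (j ℤ.- + i) ≈ 0#) →
             (q ⋆ g) j ≈ coeff 𝔽 q d * g (j ℤ.- + d)
  ⋆-single []      g d       j h = sym (zeroˡ _)
  ⋆-single (a ∷ q) g zero    j h = begin
    a * g j + (q ⋆ g) (j ℤ.- 1ℤ)  ≈⟨ +-congˡ (⋆-vanishes-at q g _ (λ i → shifted g j i (h (suc i) λ ()))) ⟩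
    a * g j + 0#                  ≈⟨ +-identityʳ _ ⟩
    a * g j                       ≈⟨ *-congˡ (at g (ℤₚ.+-identityʳ j)) ⟨
    a * g (j ℤ.- + 0)             ∎
  ⋆-single (a ∷ q) g (suc d) j h = begin
    a * g j + (q ⋆ g) (j ℤ.- 1ℤ)
      ≈⟨ +-cong (head≈0 g j (h 0 λ ()))
                (⋆-single q g d _ λ i i≢d → shifted g j i (h (suc i) (i≢d ∘ ℕₚ.suc-injective))) ⟩
    0# + coeff 𝔽 q d * g ((j ℤ.- 1ℤ) ℤ.- + d)
      ≈⟨ +-identityˡ _ ⟩
    coeff 𝔽 q d * g ((j ℤ.- 1ℤ) ℤ.- + d)
      ≈⟨ *-congˡ (at g (j-[1+i]≡[j-1]-i j d)) ⟨
    coeff 𝔽 q d * g (j ℤ.- + suc d) ∎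

  ⋆-vanishes-at q g j h = trans (⋆-single q g (length q) j (λ i _ → h i))
    (trans (*-congʳ (coeff-beyond-length q ℕₚ.≤-refl)) (zeroˡ _))

  ⋆-vanishesFrom : ∀ q {g A B} → CoeffsVanishFrom A q → VanishesFrom B g →
                   VanishesFrom ((A ℤ.+ B) ℤ.- 1ℤ) (q ⋆ g)
  ⋆-vanishesFrom q {g} {A} q<A g<B j A+B-1≤j = ⋆-vanishes-at q g j coefficient-or-term
    where
    coefficient-or-term : ∀ i → coeff 𝔽 q i ≈ 0# ⊎ g (j ℤ.- + i) ≈ 0#
    coefficient-or-term i with A ℤₚ.≤? + i
    ... | yes A≤i = inj₁ (q<A i A≤i)
    ... | no  A≰i = inj₂ (g<B _ ([A+B]-1≤j∧i<A⇒B≤j-i A+B-1≤j (ℤₚ.≰⇒> A≰i)))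

  -- Reading off the coefficient of T^(T+d) of q·g, where d = deg q, kills g at T.
  ⋆-cancel-top : ∀ q {g d} T → coeff 𝔽 q d ≉ 0# → (∀ i → d ℕ.< i → coeff 𝔽 q i ≈ 0#) →
                 VanishesFrom (1ℤ ℤ.+ T) g → (q ⋆ g) (T ℤ.+ + d) ≈ 0# → g T ≈ 0#
  ⋆-cancel-top q {g} {d} T q_d≉0 q-above g<1+T q⋆g≈0 =
    x≉0∧xy≈0⇒y≈0 q_d≉0 (begin
      coeff 𝔽 q d * g T                        ≈⟨ *-congˡ (at g ([i+j]-j≡i T (+ d))) ⟨
      coeff 𝔽 q d * g ((T ℤ.+ + d) ℤ.- + d)    ≈⟨ ⋆-single q g d (T ℤ.+ + d) only-d ⟨
      (q ⋆ g) (T ℤ.+ + d)                      ≈⟨ q⋆g≈0 ⟩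
      0#                                       ∎)
    where
    only-d : ∀ i → i ≢ d → coeff 𝔽 q i ≈ 0# ⊎ g ((T ℤ.+ + d) ℤ.- + i) ≈ 0#
    only-d i i≢d with ℕₚ.<-cmp i d
    ... | tri< i<d _ _ = inj₂ (g<1+T _ (i<d⇒1+T≤[T+d]-i T i<d))
    ... | tri≈ _ i≡d _ = ⊥-elim (i≢d i≡d)
    ... | tri> _ _ d<i = inj₁ (q-above i d<i)

  ⋆-cancelˡ : ∀ q {g T M} → NonzeroPoly 𝔽 q → VanishesFrom T g →
              VanishesFrom M (q ⋆ g) → VanishesFrom M g
  ⋆-cancelˡ q {g} {T} {M} q≢0 g<T q⋆g<M with leading-coefficient q q≢0
  ... | d , q_d≉0 , q-above = descend ℤ.∣ T ℤ.- M ∣ (vanishesFrom-mono (i≤j+∣i-j∣ T M) g<T)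
    where
    descend : ∀ n → VanishesFrom (M ℤ.+ + n) g → VanishesFrom M g
    descend zero    g<M+0 = vanishesFrom-mono (ℤₚ.≤-reflexive (ℤₚ.+-identityʳ M)) g<M+0
    descend (suc n) g<M+1+n = descend n (vanishesFrom-extend g<1+M+n gₘ₊ₙ≈0)
      where
      g<1+M+n : VanishesFrom (1ℤ ℤ.+ (M ℤ.+ + n)) g
      g<1+M+n = ≡.subst (λ B → VanishesFrom B g) (i+[1+n]≡1+[i+n] M n) g<M+1+n
      gₘ₊ₙ≈0 : g (M ℤ.+ + n) ≈ 0#
      gₘ₊ₙ≈0 = ⋆-cancel-top q (M ℤ.+ + n) q_d≉0 q-above g<1+M+n
        (q⋆g<M _ (ℤₚ.≤-trans (ℤₚ.i≤i+j M (+ n)) (ℤₚ.i≤i+j _ (+ d))))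

  module _ (α : Laurent 𝔽) {k : ℕ} (improvable : DirichletImprovable 𝔽 k α) where
    private
      N₀ : ℕ
      N₀ = proj₁ improvable

      approximation : ∀ t → ∃[ p ] ∃[ q ] (NonzeroPoly 𝔽 q
        × CoeffsVanishFrom (+ (t ℕ.+ N₀) ℤ.- + k) q
        × VanishesFrom (ℤ.- + k ℤ.- + (t ℕ.+ N₀)) (errCf 𝔽 p q α))
      approximation t = proj₂ improvable (t ℕ.+ N₀) (ℕₚ.m≤n+m N₀ t)

      p q : ℕ → Poly 𝔽
      p t = proj₁ (approximation t)
      q t = proj₁ (proj₂ (approximation t))

      e : ℕ → Series
      e t = errCf 𝔽 (p t) (q t) α

      q≢0 : ∀ t → NonzeroPoly 𝔽 (q t)
      q≢0 t = proj₁ (proj₂ (proj₂ (approximation t)))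

      q-degree : ∀ t → CoeffsVanishFrom (+ (t ℕ.+ N₀) ℤ.- + k) (q t)
      q-degree t = proj₁ (proj₂ (proj₂ (proj₂ (approximation t))))

      e-vanishes : ∀ t → VanishesFrom (ℤ.- + k ℤ.- + (t ℕ.+ N₀)) (e t)
      e-vanishes t = proj₂ (proj₂ (proj₂ (proj₂ (approximation t))))

      q⋆e-vanishes : ∀ a b → VanishesFrom (a ⊖ suc b) (q a ⋆ e b)
      q⋆e-vanishes a b = vanishesFrom-mono ([a+N-k]+[-k-[b+N]]-1≤a⊖[1+b] k N₀ a b)
        (⋆-vanishesFrom (q a) (q-degree a) (e-vanishes b))

      consecutive : ∀ t → q (suc t) ⋆ e t ≋ q t ⋆ e (suc t)
      consecutive t (+ m) = trans
        (q⋆e-vanishes (suc t) t (+ m) (m≤n⇒m⊖n≤+k {suc t} m ℕₚ.≤-refl))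
        (sym (q⋆e-vanishes t (suc t) (+ m) (m≤n⇒m⊖n≤+k m (ℕₚ.m≤n+m t 2))))
      consecutive t -[1+ m ] = begin
        (q (suc t) ⋆ e t) -[1+ m ]            ≈⟨ ⋆-errCf-negative (q (suc t)) (p t) (q t) α m ⟩
        (q (suc t) ⋆ q t ⋆ cf α) -[1+ m ]     ≈⟨ ⋆-comm (q (suc t)) (q t) (cf α) -[1+ m ] ⟩
        (q t ⋆ q (suc t) ⋆ cf α) -[1+ m ]     ≈⟨ ⋆-errCf-negative (q t) (p (suc t)) (q (suc t)) α m ⟨
        (q t ⋆ e (suc t)) -[1+ m ]            ∎

      invariant : ∀ t → q t ⋆ e 0 ≋ q 0 ⋆ e t
      invariant zero    j = refl
      invariant (suc t) j = x∙y⁻¹≈ε⇒x≈y _ _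
        (⋆-cancelˡ (q t) (q≢0 t) bounded (λ i _ → annihilated i) j ℤₚ.≤-refl)
        where
        difference : Series
        difference i = (q (suc t) ⋆ e 0) i - (q 0 ⋆ e (suc t)) i

        bounded : VanishesFrom (+ suc t) difference
        bounded = vanishesFrom-minus
          (vanishesFrom-mono (ℤₚ.m⊖n≤m (suc t) 1) (q⋆e-vanishes (suc t) 0))
          (vanishesFrom-mono (ℤₚ.0⊖m≤+ (suc (suc t))) (q⋆e-vanishes 0 (suc t)))

        annihilated : q t ⋆ difference ≋ λ _ → 0#
        annihilated i = begin
          (q t ⋆ difference) i
            ≈⟨ ⋆[f-g]≋⋆f-⋆g (q t) _ _ i ⟩
          (q t ⋆ q (suc t) ⋆ e 0) i - (q t ⋆ q 0 ⋆ e (suc t)) i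
            ≈⟨ +-cong (⋆-comm (q t) (q (suc t)) (e 0) i) (-‿cong (⋆-comm (q t) (q 0) (e (suc t)) i)) ⟩
          (q (suc t) ⋆ q t ⋆ e 0) i - (q 0 ⋆ q t ⋆ e (suc t)) i
            ≈⟨ +-cong (⋆-congˡ (q (suc t)) (invariant t) i)
                      (-‿cong (⋆-congˡ (q 0) (λ i′ → sym (consecutive t i′)) i)) ⟩
          (q (suc t) ⋆ q 0 ⋆ e t) i - (q 0 ⋆ q (suc t) ⋆ e t) i
            ≈⟨ +-congʳ (⋆-comm (q (suc t)) (q 0) (e t) i) ⟩
          (q 0 ⋆ q (suc t) ⋆ e t) i - (q 0 ⋆ q (suc t) ⋆ e t) i
            ≈⟨ -‿inverseʳ _ ⟩
          0# ∎

      e₀-vanishes : ∀ t → VanishesFrom -[1+ t ] (e 0)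
      e₀-vanishes t = ⋆-cancelˡ (q t) (q≢0 t) (e-vanishes 0)
        (λ j -[1+t]≤j → trans (invariant t j) (q⋆e-vanishes 0 t j -[1+t]≤j))

      e₀≋0 : e 0 ≋ λ _ → 0#
      e₀≋0 (+ m)    = e₀-vanishes 0 (+ m) ℤ.-≤+
      e₀≋0 -[1+ m ] = e₀-vanishes m -[1+ m ] ℤₚ.≤-refl

    improvable⇒rational : IsRational 𝔽 α
    improvable⇒rational = p 0 , q 0 , q≢0 0 , λ j → x∙y⁻¹≈ε⇒x≈y _ _ (e₀≋0 j)

  rational⇒improvable : ∀ α → IsRational 𝔽 α → DirichletImprovable 𝔽 1 α
  rational⇒improvable α (a , b , b≢0 , b⋆α≋a) =
    suc (length b) , λ n 1+l≤n → a , b , b≢0 , deg-b<n-1 n 1+l≤n , λ j _ → x≈y⇒x∙y⁻¹≈ε (b⋆α≋a j)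
    where
    deg-b<n-1 : ∀ n → suc (length b) ℕ.≤ n → CoeffsVanishFrom (+ n ℤ.- + 1) b
    deg-b<n-1 (suc n) (s≤s l≤n) i (ℤ.+≤+ n≤i) = coeff-beyond-length b (ℕₚ.≤-trans l≤n n≤i)

open import Data.Nat using (_≤_)

theorem2p4 : {c ℓ : Level} (𝔽 : FiniteField c ℓ) (α : Laurent 𝔽) →
    (∃[ k ] (1 ≤ k × DirichletImprovable 𝔽 k α)) ⇔ IsRational 𝔽 α
theorem2p4 𝔽 α = mk⇔
  (λ (k , _ , improvable) → improvable⇒rational 𝔽 α {k} improvable)
  (λ rational → 1 , s≤s z≤n , rational⇒improvable 𝔽 α rational)
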